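{- Let $r\geq 2$ be an integer and $\mathcal{H}$ an $r$-uniform hypergraph. Then there is a hypergraph homomorphism from $\mathcal{C}_{P(B_{\text{edge}}(\mathcal{H}))}^{(r)}$ to $\mathcal{H}$; in particular $\chi\big(\mathcal{C}_{P(B_{\text{edge}}(\mathcal{H}))}^{(r)}\big)\leq\chi(\mathcal{H})$.
   Context: A hypergraph is a pair $(V,E)$ with $V$ finite and $E$ a set of nonempty subsets of $V$; it is $r$-uniform if all edges have size $r$. A homomorphism $\mathcal H_1\to\mathcal H_2$ is a map $\psi:V_1\to V_2$ with $\psi(e)\in E_2$ for all $e\in E_1$. $\chi$ is the least $m$ admitting a map $V\to\{1,\dots,m\}$ with no monochromatic edge. $B_{\text{edge}}(\mathcal H)$: vertices are ordered $r$-tuples $(u_1,\dots,u_r)$ with $\{u_1,\dots,u_r\}\in E(\mathcal H)$; a set $T$ of such tuples is a simplex iff the projections $\pi_1(T),\dots,\pi_r(T)$ (sets of $i$-th coordinates) are pairwise disjoint and $\{x_1,\dots,x_r\}\in E(\mathcal H)$ for every choice $x_i\in\pi_i(T)$. $\mathbb Z/r$ acts on it by cyclic shift of coordinates. $P(B_{\text{edge}}(\mathcal H))$ is its face poset (simplices ordered by inclusion) with the induced $\mathbb Z/r$-action. For a $G$-poset $P$ (order-preserving $G$-action) and $r\ge2$, $\mathcal C_P^{(r)}$ is the $r$-uniform hypergraph on $P$ whose edges are the $r$-sets $\{p_1,\dots,p_r\}$ of distinct elements such that for all distinct $p_i,p_j$ there is $g\ne e$ in $G$ with $p_i$ and $g\cdot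 p_j$ comparable. -}

module Defs where

open import Data.Nat using (ℕ; zero; suc; _≤_)
open import Data.Bool using (Bool; true; false)
open import Data.Fin using (Fin; toℕ)
  renaming (zero to fzero)
open import Data.Fin.Subset using (Subset; ⁅_⁆; _∪_; ∣_∣) renaming (⊥ to ∅)
open import Data.Vec using (Vec; []; _∷_; _∷ʳ_; lookup; tabulate)
open import Data.Product using (Σ; ∃; _×_; _,_; proj₁)
open import Data.Sum using (_⊎_)
open import Data.Empty using (⊥)
open import Relation.Nullary using (¬_)
open import Relation.Binary.PropositionalEquality using (_≡_; _≢_)

record Hypergraph (n : ℕ) : Set where
  field
    isEdge : Subset n → Bool

open Hypergraph public

IsEdge : ∀ {n} → Hypergraph n → Subset n → Set
IsEdge H e = isEdge H e ≡ true

Uniform : ∀ {n} → ℕ → Hypergraph n → Set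
Uniform r H = ∀ e → IsEdge H e → ∣ e ∣ ≡ r

setOf : ∀ {n k} → Vec (Fin n) k → Subset n
setOf []       = ∅
setOf (x ∷ xs) = ⁅ x ⁆ ∪ setOf xs

-- B_edge(H): vertices are ordered r-tuples whose underlying set is an edge.

Tuple : ℕ → ℕ → Set
Tuple n r = Vec (Fin n) r

IsBVertex : ∀ {n r} → Hypergraph n → Tuple n r → Set
IsBVertex H t = IsEdge H (setOf t)

TupleSet : ℕ → ℕ → Set
TupleSet n r = Tuple n r → Bool

_∈T_ : ∀ {n r} → Tuple n r → TupleSet n r → Set
t ∈T T = T t ≡ true

record IsSimplex {n r : ℕ} (H : Hypergraph n) (T : TupleSet n r) : Set where
  field
    nonempty  : ∃ λ t → t ∈T T
    vertices  : ∀ t → t ∈T T → IsBVertex H t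
    disjoint  : ∀ (i j : Fin r) → i ≢ j → ∀ t t' → t ∈T T → t' ∈T T →
                lookup t i ≢ lookup t' j
    choices   : ∀ (c : Fin r → Tuple n r) → (∀ i → c i ∈T T) →
                IsEdge H (setOf (tabulate λ i → lookup (c i) i))

Simplex : ∀ {n} (r : ℕ) → Hypergraph n → Set
Simplex {n} r H = Σ (TupleSet n r) (IsSimplex H)

_⊆S_ : ∀ {n r} {H : Hypergraph n} → Simplex r H → Simplex r H → Set
σ ⊆S τ = ∀ t → t ∈T proj₁ σ → t ∈T proj₁ τ

_≐S_ : ∀ {n r} {H : Hypergraph n} → Simplex r H → Simplex r H → Set
σ ≐S τ = ∀ t → proj₁ σ t ≡ proj₁ τ t

-- Z/r acting by cyclic shift of coordinates; g ∈ Z/r is represented by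
-- g : Fin r, acting as the shift (u_1,...,u_r) ↦ (u_{1+g},...,u_{r+g}).

rotate1 : ∀ {A : Set} {k} → Vec A k → Vec A k
rotate1 []       = []
rotate1 (x ∷ xs) = xs ∷ʳ x

rotateN : ∀ {A : Set} {k} → ℕ → Vec A k → Vec A k
rotateN zero    v = v
rotateN (suc m) v = rotate1 (rotateN m v)

shift : ∀ {n r} → Fin r → Tuple n r → Tuple n r
shift g t = rotateN (toℕ g) t

-- σ and g·τ are comparable in P, where g·τ = { shift g s | s ∈ τ }.
ComparableShift : ∀ {n r} {H : Hypergraph n} →
                  Simplex r H → Fin r → Simplex r H → Set
ComparableShift σ g τ =
  (∀ t → t ∈T proj₁ σ → ∃ λ s → s ∈T proj₁ τ × shift g s ≡ t)
  ⊎ (∀ s → s ∈T proj₁ τ → shift g s ∈T proj₁ σ)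

-- C^{(r)}_{P(B_edge(H))}: an edge is an r-set {p_1,...,p_r} of distinct
-- elements of P, enumerated by p : Fin r → P, such that for all distinct
-- p_i, p_j there is g ≠ e in Z/r with p_i comparable to g·p_j.

IsCEdge : ∀ {n r} (H : Hypergraph n) → (Fin r → Simplex r H) → Set
IsCEdge {r = r} H p =
  (∀ i j → i ≢ j → ¬ (p i ≐S p j)) ×
  (∀ i j → i ≢ j → ∃ λ (g : Fin r) → toℕ g ≢ 0 × ComparableShift (p i) g (p j))

-- Hypergraph homomorphism C^{(r)}_{P(B_edge(H))} → H (a map on the
-- elements of P, i.e. respecting equality of simplices as sets).
IsHomCH : ∀ {n r} (H : Hypergraph n) → (Simplex r H → Fin n) → Set
IsHomCH {r = r} H ψ =
  (∀ σ τ → σ ≐S τ → ψ σ ≡ ψ τ) ×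
  (∀ (p : Fin r → Simplex r H) → IsCEdge H p →
     IsEdge H (setOf (tabulate λ i → ψ (p i))))

_∈S_ : ∀ {n} → Fin n → Subset n → Set
v ∈S e = lookup e v ≡ true

ColorableH : ∀ {n} → Hypergraph n → ℕ → Set
ColorableH {n} H m =
  Σ (Fin n → Fin m) λ c →
    ∀ e → IsEdge H e → ¬ (∀ u v → u ∈S e → v ∈S e → c u ≡ c v)

ColorableC : ∀ {n} (r : ℕ) (H : Hypergraph n) → ℕ → Set
ColorableC r H m =
  Σ (Simplex r H → Fin m) λ c →
    (∀ σ τ → σ ≐S τ → c σ ≡ c τ) ×
    (∀ (p : Fin r → Simplex r H) → IsCEdge H p →
       ¬ (∀ i j → c (p i) ≡ c (p j)))

-- χ(C) ≤ χ(H), stated as: every m admitting a proper colouring of H admits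
-- one of C (both chromatic numbers exist since edges have size r ≥ 2).
ChiLe : ∀ {n} (r : ℕ) (H : Hypergraph n) → Set
ChiLe r H = ∀ m → ColorableH H m → ColorableC r H m

module Submission where

-- The homomorphism ψ : C^{(r)}_{P(B_edge(H))} → H sends a simplex σ to the
-- first coordinate of a canonically chosen tuple of σ.  Why it maps edges
-- to edges:
--   * By disjointness of the projections, a vertex x of H occurs in a
--     simplex σ in at most one coordinate, its *position* in σ (a point of
--     Z/r).  If σ ⊆ g·τ or g·τ ⊆ σ, positions of common vertices differ by
--     a fixed nonzero shift in Z/r: an *arrow* σ ⟶ τ or τ ⟶ σ.
--   * Two arrows σ ⟶ τ ⟶ ρ compose to an arrow σ ⟶ ρ as soon as σ, ρ are
--     linked by some arrow: a composite shift 0 would contradict it.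
--   * So on an edge {p_1, …, p_r} of C the arrows form a transitive
--     tournament, which has a sink p_m.  The vertices ψ(p_j) then occupy r
--     pairwise distinct, hence all, positions of p_m, and the "choices"
--     axiom of the simplex p_m says exactly that {ψ(p_j)} is an edge of H.

open import Defs
open import Data.Nat using (ℕ; zero; suc; _+_; _∸_; _<_; _≤_; NonZero; _%_; s≤s)
open import Data.Nat.Properties
  using (+-comm; +-assoc; +-identityʳ; 1+n≰n; <⇒≤; m+[n∸m]≡n; m∸n+n≡m;
         n≢0⇒n>0; ∸-monoʳ-<; m>n⇒m∸n≢0)
open import Data.Nat.DivMod using (m%n<n; m<n⇒m%n≡m; n%n≡0; m%n%n≡m%n; %-distribˡ-+; [m+n]%n≡m%n)
open import Data.Bool using (true; if_then_else_)
open import Data.Fin using (Fin; toℕ; fromℕ; fromℕ<; inject₁; punchOut) renaming (zero to fzero; suc to fsuc)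
open import Data.Fin.Properties
  using (toℕ-injective; toℕ<n; toℕ-fromℕ<; toℕ-fromℕ; toℕ-inject₁; punchOut-injective;
         any?; injective⇒≤; _≟_)
open import Data.Fin.Subset using (_∈_; _⊆_; ⁅_⁆)
open import Data.Fin.Subset.Properties using (∉⊥; x∈⁅x⁆; x∈⁅y⁆⇒x≡y; x∈p∪q⁻; x∈p∪q⁺; ⊆-antisym)
open import Data.Vec using (Vec; []; _∷_; _∷ʳ_; lookup; tabulate)
open import Data.Vec.Properties using (lookup∘tabulate; tabulate-cong; lookup⇒[]=)
open import Data.Maybe using (Maybe; just; nothing; fromMaybe; _<∣>_) renaming (map to mapMaybe)
open import Data.Maybe.Properties using (just-injective)
open import Data.List using ([]; _∷_; allFin)
open import Data.List.Membership.Propositional using () renaming (_∈_ to _∈ₗ_)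
open import Data.List.Membership.Propositional.Properties using (∈-allFin)
open import Data.List.Relation.Unary.Any using (here; there)
open import Data.Product using (Σ; ∃; _×_; _,_; proj₁; proj₂)
open import Data.Sum using (_⊎_; inj₁; inj₂) renaming (map to map⊎)
open import Data.Empty using (⊥-elim)
open import Relation.Nullary using (¬_; yes; no)
open import Relation.Binary.Definitions using (DecidableEquality)
open import Relation.Binary.PropositionalEquality
open import Function using (_∘_)
open import Function.Definitions using (Injective)

∈setOf⁻ : ∀ {n k} (v : Vec (Fin n) k) {y} → y ∈ setOf v → ∃ λ i → lookup v i ≡ y
∈setOf⁻ []      y∈ = ⊥-elim (∉⊥ y∈)
∈setOf⁻ (x ∷ v) y∈ with x∈p∪q⁻ ⁅ x ⁆ (setOf v) y∈
... | inj₁ y∈⁅x⁆ = fzero , sym (x∈⁅y⁆⇒x≡y x y∈⁅x⁆)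
... | inj₂ y∈v   = let (i , eq) = ∈setOf⁻ v y∈v in fsuc i , eq

∈setOf⁺ : ∀ {n k} (v : Vec (Fin n) k) i → lookup v i ∈ setOf v
∈setOf⁺ (x ∷ v) fzero    = x∈p∪q⁺ (inj₁ (x∈⁅x⁆ x))
∈setOf⁺ (x ∷ v) (fsuc i) = x∈p∪q⁺ (inj₂ (∈setOf⁺ v i))

∈S-tabulate : ∀ {n k} (f : Fin k → Fin n) {u} → u ∈S setOf (tabulate f) → ∃ λ i → f i ≡ u
∈S-tabulate f {u} u∈ with ∈setOf⁻ (tabulate f) (lookup⇒[]= u (setOf (tabulate f)) u∈)
... | i , eq = i , trans (sym (lookup∘tabulate f i)) eq

setOf-reindex : ∀ {n k l} (f : Fin k → Fin n) (π : Fin l → Fin k) →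
                (∀ j → ∃ λ i → π i ≡ j) →
                setOf (tabulate (f ∘ π)) ≡ setOf (tabulate f)
setOf-reindex f π onto = ⊆-antisym forward backward
  where
  forward : setOf (tabulate (f ∘ π)) ⊆ setOf (tabulate f)
  forward y∈ with ∈setOf⁻ (tabulate (f ∘ π)) y∈
  ... | i , refl = subst (_∈ setOf (tabulate f))
                     (trans (lookup∘tabulate f (π i)) (sym (lookup∘tabulate (f ∘ π) i)))
                     (∈setOf⁺ (tabulate f) (π i))
  backward : setOf (tabulate f) ⊆ setOf (tabulate (f ∘ π))
  backward y∈ with ∈setOf⁻ (tabulate f) y∈
  ... | j , refl with onto j
  ...   | i , refl = subst (_∈ setOf (tabulate (f ∘ π)))
                       (trans (lookup∘tabulate (f ∘ π) i) (sym (lookup∘tabulate f (π i))))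
                       (∈setOf⁺ (tabulate (f ∘ π)) i)

-- An extensional choice operator on nonempty sets of tuples: the first
-- element in lexicographic order.  It depends only on the values of the
-- characteristic function, so equal simplices get equal representatives.

firstFin : ∀ {A : Set} n → (Fin n → Maybe A) → Maybe A
firstFin zero    f = nothing
firstFin (suc n) f = f fzero <∣> firstFin n (f ∘ fsuc)

firstTuple : ∀ {n} r → TupleSet n r → Maybe (Tuple n r)
firstTuple     zero    T = if T [] then just [] else nothing
firstTuple {n} (suc r) T = firstFin n λ x → mapMaybe (x ∷_) (firstTuple r (T ∘ (x ∷_)))

firstFin-sound : ∀ {A : Set} n (f : Fin n → Maybe A) {a} → firstFin n f ≡ just a → ∃ λ x → f x ≡ just a
firstFin-sound (suc n) f eq with f fzero in f0
... | just _  = fzero , trans f0 eq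
... | nothing = let (x , fx) = firstFin-sound n (f ∘ fsuc) eq in fsuc x , fx

firstFin-complete : ∀ {A : Set} n (f : Fin n → Maybe A) x {a} → f x ≡ just a → ∃ λ b → firstFin n f ≡ just b
firstFin-complete (suc n) f fzero    {a} fx rewrite fx = a , refl
firstFin-complete (suc n) f (fsuc x)     fx with f fzero
... | just b  = b , refl
... | nothing = firstFin-complete n (f ∘ fsuc) x fx

firstFin-cong : ∀ {A : Set} n {f g : Fin n → Maybe A} → (∀ x → f x ≡ g x) → firstFin n f ≡ firstFin n g
firstFin-cong zero    f≗g = refl
firstFin-cong (suc n) f≗g = cong₂ _<∣>_ (f≗g fzero) (firstFin-cong n (f≗g ∘ fsuc))

firstTuple-sound : ∀ {n} r (T : TupleSet n r) {t} → firstTuple r T ≡ just t → t ∈T T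
firstTuple-sound zero T {[]} eq with T []
... | true = refl
firstTuple-sound {n} (suc r) T eq with firstFin-sound n _ eq
... | x , found with firstTuple r (T ∘ (x ∷_)) in rest | found
...   | just v | refl = firstTuple-sound r (T ∘ (x ∷_)) rest

firstTuple-complete : ∀ {n} r (T : TupleSet n r) {t} → t ∈T T → ∃ λ b → firstTuple r T ≡ just b
firstTuple-complete zero T {[]} t∈ rewrite t∈ = [] , refl
firstTuple-complete {n} (suc r) T {x ∷ v} t∈ with firstTuple-complete r (T ∘ (x ∷_)) t∈
... | w , found = firstFin-complete n _ x (cong (mapMaybe (x ∷_)) found)

firstTuple-cong : ∀ {n} r {T T' : TupleSet n r} → (∀ t → T t ≡ T' t) → firstTuple r T ≡ firstTuple r T'
firstTuple-cong zero    T≗T' = cong (λ b → if b then just [] else nothing) (T≗T' [])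
firstTuple-cong (suc r) T≗T' =
  firstFin-cong _ λ x → cong (mapMaybe (x ∷_)) (firstTuple-cong r (T≗T' ∘ (x ∷_)))

-- The chosen element of a set T witnessed nonempty by w (w is only a
-- fallback that is never used).
choose : ∀ {n r} (T : TupleSet n r) → ∃ (_∈T T) → Tuple n r
choose {r = r} T (t₀ , _) = fromMaybe t₀ (firstTuple r T)

choose-spec : ∀ {n r} (T : TupleSet n r) (w : ∃ (_∈T T)) → firstTuple r T ≡ just (choose T w)
choose-spec {r = r} T (t₀ , t₀∈) with firstTuple r T | firstTuple-complete r T t₀∈
... | just b  | _ = refl
... | nothing | _ , ()

choose-∈ : ∀ {n r} (T : TupleSet n r) (w : ∃ (_∈T T)) → choose T w ∈T T
choose-∈ {r = r} T w = firstTuple-sound r T (choose-spec T w)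

choose-cong : ∀ {n r} {T T' : TupleSet n r} (w : ∃ (_∈T T)) (w' : ∃ (_∈T T')) →
              (∀ t → T t ≡ T' t) → choose T w ≡ choose T' w'
choose-cong {r = r} {T} {T'} w w' T≗T' =
  just-injective (trans (sym (choose-spec T w)) (trans (firstTuple-cong r T≗T') (choose-spec T' w')))

-- Positions live in Z/r, represented by Fin r; i ⊕ d is i shifted by d.

module _ {r : ℕ} .{{_ : NonZero r}} where

  infixl 6 _⊕_
  _⊕_ : Fin r → ℕ → Fin r
  i ⊕ d = fromℕ< (m%n<n (toℕ i + d) r)

  toℕ-⊕ : ∀ i d → toℕ (i ⊕ d) ≡ (toℕ i + d) % r
  toℕ-⊕ i d = toℕ-fromℕ< (m%n<n (toℕ i + d) r)

  %-absorbˡ : ∀ a b → (a % r + b) % r ≡ (a + b) % r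
  %-absorbˡ a b = begin
    (a % r + b) % r           ≡⟨ %-distribˡ-+ (a % r) b r ⟩
    (a % r % r + b % r) % r   ≡⟨ cong (λ z → (z + b % r) % r) (m%n%n≡m%n a r) ⟩
    (a % r + b % r) % r       ≡⟨ %-distribˡ-+ a b r ⟨
    (a + b) % r               ∎
    where open ≡-Reasoning

  ⊕-identityʳ : ∀ i → i ⊕ 0 ≡ i
  ⊕-identityʳ i = toℕ-injective (begin
    toℕ (i ⊕ 0)       ≡⟨ toℕ-⊕ i 0 ⟩
    (toℕ i + 0) % r   ≡⟨ cong (_% r) (+-identityʳ (toℕ i)) ⟩
    toℕ i % r         ≡⟨ m<n⇒m%n≡m (toℕ<n i) ⟩
    toℕ i             ∎)
    where open ≡-Reasoning

  ⊕-assoc : ∀ i d e → (i ⊕ d) ⊕ e ≡ i ⊕ (d + e)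
  ⊕-assoc i d e = toℕ-injective (begin
    toℕ ((i ⊕ d) ⊕ e)                 ≡⟨ toℕ-⊕ (i ⊕ d) e ⟩
    (toℕ (i ⊕ d) + e) % r             ≡⟨ cong (λ z → (z + e) % r) (toℕ-⊕ i d) ⟩
    ((toℕ i + d) % r + e) % r         ≡⟨ %-absorbˡ (toℕ i + d) e ⟩
    (toℕ i + d + e) % r               ≡⟨ cong (_% r) (+-assoc (toℕ i) d e) ⟩
    (toℕ i + (d + e)) % r             ≡⟨ toℕ-⊕ i (d + e) ⟨
    toℕ (i ⊕ (d + e))                 ∎)
    where open ≡-Reasoning

  ⊕-swap : ∀ i d e → (i ⊕ d) ⊕ e ≡ (i ⊕ e) ⊕ d
  ⊕-swap i d e = begin
    (i ⊕ d) ⊕ e   ≡⟨ ⊕-assoc i d e ⟩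
    i ⊕ (d + e)   ≡⟨ cong (i ⊕_) (+-comm d e) ⟩
    i ⊕ (e + d)   ≡⟨ ⊕-assoc i e d ⟨
    (i ⊕ e) ⊕ d   ∎
    where open ≡-Reasoning

  ⊕-cong : ∀ i {d e} → d % r ≡ e % r → i ⊕ d ≡ i ⊕ e
  ⊕-cong i {d} {e} d≡e = toℕ-injective (begin
    toℕ (i ⊕ d)                  ≡⟨ toℕ-⊕ i d ⟩
    (toℕ i + d) % r              ≡⟨ %-distribˡ-+ (toℕ i) d r ⟩
    (toℕ i % r + d % r) % r      ≡⟨ cong (λ z → (toℕ i % r + z) % r) d≡e ⟩
    (toℕ i % r + e % r) % r      ≡⟨ %-distribˡ-+ (toℕ i) e r ⟨
    (toℕ i + e) % r              ≡⟨ toℕ-⊕ i e ⟨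
    toℕ (i ⊕ e)                  ∎)
    where open ≡-Reasoning

  ⊕-cancelˡ : ∀ i {d e} → i ⊕ d ≡ i ⊕ e → d % r ≡ e % r
  ⊕-cancelˡ i {d} {e} eq = trans (sym (return d)) (trans (cong (λ j → toℕ (j ⊕ back)) eq) (return e))
    where
    back : ℕ
    back = r ∸ toℕ i
    return : ∀ a → toℕ ((i ⊕ a) ⊕ back) ≡ a % r
    return a = begin
      toℕ ((i ⊕ a) ⊕ back)       ≡⟨ cong toℕ (⊕-assoc i a back) ⟩
      toℕ (i ⊕ (a + back))       ≡⟨ toℕ-⊕ i (a + back) ⟩
      (toℕ i + (a + back)) % r   ≡⟨ cong (_% r) (trans (sym (+-assoc (toℕ i) a back))
                                     (trans (cong (_+ back) (+-comm (toℕ i) a)) (+-assoc a (toℕ i) back))) ⟩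
      (a + (toℕ i + back)) % r   ≡⟨ cong (λ z → (a + z) % r) (m+[n∸m]≡n (<⇒≤ (toℕ<n i))) ⟩
      (a + r) % r                ≡⟨ [m+n]%n≡m%n a r ⟩
      a % r                      ∎
      where open ≡-Reasoning

  ⊕-complement : ∀ i (g : Fin r) → (i ⊕ (r ∸ toℕ g)) ⊕ toℕ g ≡ i
  ⊕-complement i g = begin
    (i ⊕ (r ∸ toℕ g)) ⊕ toℕ g   ≡⟨ ⊕-assoc i (r ∸ toℕ g) (toℕ g) ⟩
    i ⊕ (r ∸ toℕ g + toℕ g)     ≡⟨ ⊕-cong i (trans (cong (_% r) (m∸n+n≡m (<⇒≤ (toℕ<n g))))
                                               ([m+n]%n≡m%n 0 r)) ⟩
    i ⊕ 0                       ≡⟨ ⊕-identityʳ i ⟩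
    i                           ∎
    where open ≡-Reasoning

-- Rotation by m moves coordinate i ⊕ m to coordinate i; this turns the
-- action g·τ into a shift of positions.  First, the coordinates of xs ∷ʳ x.

lookup-∷ʳ-inject₁ : ∀ {A : Set} {k} (xs : Vec A k) x j → lookup (xs ∷ʳ x) (inject₁ j) ≡ lookup xs j
lookup-∷ʳ-inject₁ (y ∷ ys) x fzero    = refl
lookup-∷ʳ-inject₁ (y ∷ ys) x (fsuc j) = lookup-∷ʳ-inject₁ ys x j

lookup-∷ʳ-last : ∀ {A : Set} {k} (xs : Vec A k) x → lookup (xs ∷ʳ x) (fromℕ k) ≡ x
lookup-∷ʳ-last []       x = refl
lookup-∷ʳ-last (y ∷ ys) x = lookup-∷ʳ-last ys x

last-or-inject₁ : ∀ {k} (i : Fin (suc k)) → i ≡ fromℕ k ⊎ ∃ λ j → i ≡ inject₁ j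
last-or-inject₁ {zero}  fzero    = inj₁ refl
last-or-inject₁ {suc k} fzero    = inj₂ (fzero , refl)
last-or-inject₁ {suc k} (fsuc i) = map⊎ (cong fsuc) (λ (j , eq) → fsuc j , cong fsuc eq) (last-or-inject₁ i)

rotate1-lookup : ∀ {A : Set} {k} (v : Vec A (suc k)) i → lookup (rotate1 v) i ≡ lookup v (i ⊕ 1)
rotate1-lookup {k = k} (x ∷ xs) i with last-or-inject₁ i
... | inj₁ refl = trans (lookup-∷ʳ-last xs x) (cong (lookup (x ∷ xs)) (sym last⊕1))
  where
  last⊕1 : fromℕ k ⊕ 1 ≡ fzero
  last⊕1 = toℕ-injective (begin
    toℕ (fromℕ k ⊕ 1)            ≡⟨ toℕ-⊕ (fromℕ k) 1 ⟩
    (toℕ (fromℕ k) + 1) % suc k  ≡⟨ cong (λ z → (z + 1) % suc k) (toℕ-fromℕ k) ⟩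
    (k + 1) % suc k              ≡⟨ cong (_% suc k) (+-comm k 1) ⟩
    suc k % suc k                ≡⟨ n%n≡0 (suc k) ⟩
    0                            ∎)
    where open ≡-Reasoning
... | inj₂ (j , refl) = trans (lookup-∷ʳ-inject₁ xs x j) (cong (lookup (x ∷ xs)) (sym inject₁⊕1))
  where
  inject₁⊕1 : inject₁ j ⊕ 1 ≡ fsuc j
  inject₁⊕1 = toℕ-injective (begin
    toℕ (inject₁ j ⊕ 1)            ≡⟨ toℕ-⊕ (inject₁ j) 1 ⟩
    (toℕ (inject₁ j) + 1) % suc k  ≡⟨ cong (λ z → (z + 1) % suc k) (toℕ-inject₁ j) ⟩
    (toℕ j + 1) % suc k            ≡⟨ cong (_% suc k) (+-comm (toℕ j) 1) ⟩
    suc (toℕ j) % suc k            ≡⟨ m<n⇒m%n≡m (s≤s (toℕ<n j)) ⟩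
    suc (toℕ j)                    ∎)
    where open ≡-Reasoning

rotateN-lookup : ∀ {A : Set} {k} m (v : Vec A (suc k)) i → lookup (rotateN m v) i ≡ lookup v (i ⊕ m)
rotateN-lookup zero    v i = cong (lookup v) (sym (⊕-identityʳ i))
rotateN-lookup (suc m) v i = begin
  lookup (rotate1 (rotateN m v)) i   ≡⟨ rotate1-lookup (rotateN m v) i ⟩
  lookup (rotateN m v) (i ⊕ 1)       ≡⟨ rotateN-lookup m v (i ⊕ 1) ⟩
  lookup v ((i ⊕ 1) ⊕ m)             ≡⟨ cong (lookup v) (⊕-assoc i 1 m) ⟩
  lookup v (i ⊕ suc m)               ∎
  where open ≡-Reasoning

-- Every tournament-like relation (total and transitive on distinct elements)
-- has a sink for any finite list of elements (the default a is only used
-- for the empty list).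

module _ {A : Set} (_≟ᴬ_ : DecidableEquality A) (R : A → A → Set)
         (total : ∀ {a b} → a ≢ b → R a b ⊎ R b a)
         (transitive : ∀ {a b c} → a ≢ c → R a b → R b c → R a c) where

  sink : A → ∀ as → ∃ λ m → ∀ {j} → j ∈ₗ as → j ≢ m → R j m
  sink a [] = a , λ ()
  sink a (b ∷ bs) with sink a bs
  ... | m , toM with b ≟ᴬ m
  ...   | yes refl = m , λ { (here refl) m≢m → ⊥-elim (m≢m refl) ; (there j∈) → toM j∈ }
  ...   | no b≢m with total b≢m
  ...     | inj₁ bRm = m , λ { (here refl) _ → bRm ; (there j∈) → toM j∈ }
  ...     | inj₂ mRb = b , toB
    where
    toB : ∀ {j} → j ∈ₗ b ∷ bs → j ≢ b → R j b
    toB (here refl) b≢b = ⊥-elim (b≢b refl)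
    toB {j} (there j∈) j≢b with j ≟ᴬ m
    ... | yes refl = mRb
    ... | no j≢m   = transitive j≢b (toM j∈ j≢m) mRb

injective⇒onto : ∀ {k} (f : Fin k → Fin k) → Injective _≡_ _≡_ f → ∀ y → ∃ λ x → f x ≡ y
injective⇒onto {suc k} f f-inj y with any? (λ x → f x ≟ y)
... | yes hit = hit
... | no miss = ⊥-elim (1+n≰n (injective⇒≤ {f = avoid} avoid-inj))
  where
  -- without a preimage of y, f would inject Fin (suc k) into Fin k
  avoid : Fin (suc k) → Fin k
  avoid x = punchOut {i = y} {j = f x} (λ y≡fx → miss (x , sym y≡fx))
  avoid-inj : Injective _≡_ _≡_ avoid
  avoid-inj {a} {b} eq = f-inj (punchOut-injective (λ y≡fa → miss (a , sym y≡fa))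
                                                    (λ y≡fb → miss (b , sym y≡fb)) eq)

module Construction {n k : ℕ} (H : Hypergraph n) where

  Face : Set
  Face = Simplex (suc k) H

  Occurs : Face → Fin n → Fin (suc k) → Set
  Occurs σ x i = ∃ λ t → t ∈T proj₁ σ × lookup t i ≡ x

  -- Disjointness of the projections: a vertex has at most one position.
  occurs-unique : ∀ σ {x i j} → Occurs σ x i → Occurs σ x j → i ≡ j
  occurs-unique σ {i = i} {j} (t , t∈ , tx) (t' , t'∈ , t'x) with i ≟ j
  ... | yes i≡j = i≡j
  ... | no  i≢j = ⊥-elim (IsSimplex.disjoint (proj₂ σ) i j i≢j t t' t∈ t'∈ (trans tx (sym t'x)))

  record Shifts (σ : Face) (d : ℕ) (τ : Face) : Set where
    constructor shifts
    field carry : ∀ {x i} → Occurs σ x i → Occurs τ x (i ⊕ d)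
  open Shifts

  shifts-refl : ∀ σ → Shifts σ 0 σ
  shifts-refl σ = shifts λ {x} occ → subst (Occurs σ x) (sym (⊕-identityʳ _)) occ

  shifts-trans : ∀ {σ τ ρ d e} → Shifts σ d τ → Shifts τ e ρ → Shifts σ (d + e) ρ
  shifts-trans {ρ = ρ} {d} {e} S S' =
    shifts λ {x} {i} occ → subst (Occurs ρ x) (⊕-assoc i d e) (carry S' (carry S occ))

  shifts-cong : ∀ {σ τ d e} → d % suc k ≡ e % suc k → Shifts σ d τ → Shifts σ e τ
  shifts-cong {τ = τ} d≡e S = shifts λ {x} {i} occ → subst (Occurs τ x) (⊕-cong i d≡e) (carry S occ)

  -- Since σ is nonempty, the amount of a shift σ → τ is determined mod r.
  shifts-determined : ∀ σ {τ d e} → Shifts σ d τ → Shifts σ e τ → d % suc k ≡ e % suc k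
  shifts-determined σ {τ} {d} {e} S S' with IsSimplex.nonempty (proj₂ σ)
  ... | t , t∈ = ⊕-cancelˡ fzero {d} {e} (occurs-unique τ (carry S occ) (carry S' occ))
    where
    occ : Occurs σ (lookup t fzero) fzero
    occ = t , t∈ , refl

  Arrow : Face → Face → Set
  Arrow σ τ = ∃ λ d → d % suc k ≢ 0 × Shifts σ d τ

  Linked : Face → Face → Set
  Linked σ τ = Arrow σ τ ⊎ Arrow τ σ

  aligned⇒unlinked : ∀ {σ τ} → Shifts σ 0 τ → ¬ Linked σ τ
  aligned⇒unlinked {σ} S₀ (inj₁ (f , f≢0 , F)) = f≢0 (sym (shifts-determined σ S₀ F))
  aligned⇒unlinked {σ} S₀ (inj₂ (f , f≢0 , F)) =
    f≢0 (shifts-determined σ (shifts-trans S₀ F) (shifts-refl σ))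

  -- Arrows compose as long as the endpoints are linked; this is where the
  -- edge condition of C for the pair (σ, ρ) enters.
  arrow-trans : ∀ {σ τ ρ} → Linked σ ρ → Arrow σ τ → Arrow τ ρ → Arrow σ ρ
  arrow-trans link (d , _ , D) (e , _ , E) =
    d + e , (λ d+e≡0 → aligned⇒unlinked (shifts-cong d+e≡0 (shifts-trans D E)) link) , shifts-trans D E

  comparable⇒linked : ∀ σ τ (g : Fin (suc k)) → toℕ g ≢ 0 → ComparableShift σ g τ → Linked σ τ
  comparable⇒linked σ τ g g≢0 (inj₁ σ⊆gτ) = inj₁ (toℕ g , g%≢0 , down)
    where
    g%≢0 : toℕ g % suc k ≢ 0
    g%≢0 = g≢0 ∘ trans (sym (m<n⇒m%n≡m (toℕ<n g)))
    down : Shifts σ (toℕ g) τ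
    down = shifts move
      where
      move : ∀ {x i} → Occurs σ x i → Occurs τ x (i ⊕ toℕ g)
      move {i = i} (t , t∈ , tx) with σ⊆gτ t t∈
      ... | s , s∈ , refl = s , s∈ , trans (sym (rotateN-lookup (toℕ g) s i)) tx
  comparable⇒linked σ τ g g≢0 (inj₂ gτ⊆σ) = inj₂ (suc k ∸ toℕ g , back≢0 , up)
    where
    back<r : suc k ∸ toℕ g < suc k
    back<r = ∸-monoʳ-< (n≢0⇒n>0 g≢0) (<⇒≤ (toℕ<n g))
    back≢0 : (suc k ∸ toℕ g) % suc k ≢ 0
    back≢0 = m>n⇒m∸n≢0 (toℕ<n g) ∘ trans (sym (m<n⇒m%n≡m back<r))
    up : Shifts τ (suc k ∸ toℕ g) σ
    up = shifts λ {x} {i} (s , s∈ , sx) →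
      shift g s , gτ⊆σ s s∈ ,
      trans (rotateN-lookup (toℕ g) s (i ⊕ (suc k ∸ toℕ g))) (trans (cong (lookup s) (⊕-complement i g)) sx)

  representative : Face → Tuple n (suc k)
  representative σ = choose (proj₁ σ) (IsSimplex.nonempty (proj₂ σ))

  ψ : Face → Fin n
  ψ σ = lookup (representative σ) fzero

  ψ-occurs : ∀ σ → Occurs σ (ψ σ) fzero
  ψ-occurs σ = representative σ , choose-∈ (proj₁ σ) (IsSimplex.nonempty (proj₂ σ)) , refl

  ψ-cong : ∀ σ τ → σ ≐S τ → ψ σ ≡ ψ τ
  ψ-cong σ τ σ≐τ = cong (λ t → lookup t fzero)
    (choose-cong (IsSimplex.nonempty (proj₂ σ)) (IsSimplex.nonempty (proj₂ τ)) σ≐τ)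

  -- If p m is a sink of pairwise linked faces p j, the vertices ψ (p j)
  -- fill distinct, hence all, positions of p m, so they form an edge.
  module _ (p : Fin (suc k) → Face) (linked : ∀ i j → i ≢ j → Linked (p i) (p j))
           (m : Fin (suc k)) (toSink : ∀ j → j ≢ m → Arrow (p j) (p m)) where

    reach : ∀ j → ∃ λ e → Shifts (p j) e (p m)
    reach j with j ≟ m
    ... | yes refl = 0 , shifts-refl (p m)
    ... | no  j≢m  = let (e , _ , E) = toSink j j≢m in e , E

    slot : Fin (suc k) → Fin (suc k)
    slot j = fzero ⊕ proj₁ (reach j)

    slot-occurs : ∀ j → Occurs (p m) (ψ (p j)) (slot j)
    slot-occurs j = carry (proj₂ (reach j)) (ψ-occurs (p j))

    apart : ∀ {j l} → Arrow (p j) (p l) → slot j ≢ slot l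
    apart {j} {l} (f , f≢0 , F) same = f≢0 (⊕-cancelˡ (fzero ⊕ e) (begin
      (fzero ⊕ e) ⊕ f   ≡⟨ ⊕-swap fzero e f ⟩
      (fzero ⊕ f) ⊕ e   ≡⟨ occurs-unique (p m) (carry E (carry F (ψ-occurs (p j)))) (slot-occurs j) ⟩
      slot j            ≡⟨ same ⟩
      fzero ⊕ e         ≡⟨ ⊕-identityʳ (fzero ⊕ e) ⟨
      (fzero ⊕ e) ⊕ 0   ∎))
      where
      open ≡-Reasoning
      e : ℕ
      e = proj₁ (reach l)
      E : Shifts (p l) e (p m)
      E = proj₂ (reach l)

    slot-injective : Injective _≡_ _≡_ slot
    slot-injective {j} {l} same with j ≟ l
    ... | yes j≡l = j≡l
    ... | no  j≢l with linked j l j≢l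
    ...   | inj₁ j⟶l = ⊥-elim (apart j⟶l same)
    ...   | inj₂ l⟶j = ⊥-elim (apart l⟶j (sym same))

    slot-onto : ∀ q → ∃ λ j → slot j ≡ q
    slot-onto = injective⇒onto slot slot-injective

    unslot : Fin (suc k) → Fin (suc k)
    unslot q = proj₁ (slot-onto q)

    unslot-onto : ∀ j → ∃ λ q → unslot q ≡ j
    unslot-onto j = slot j , slot-injective (proj₂ (slot-onto (slot j)))

    choice : ∀ q → Occurs (p m) (ψ (p (unslot q))) q
    choice q = subst (Occurs (p m) _) (proj₂ (slot-onto q)) (slot-occurs (unslot q))

    sink-edge : IsEdge H (setOf (tabulate λ j → ψ (p j)))
    sink-edge = subst (IsEdge H) same-set
      (IsSimplex.choices (proj₂ (p m)) (proj₁ ∘ choice) (proj₁ ∘ proj₂ ∘ choice))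
      where
      same-set : setOf (tabulate λ q → lookup (proj₁ (choice q)) q) ≡ setOf (tabulate λ j → ψ (p j))
      same-set = trans (cong setOf (tabulate-cong (proj₂ ∘ proj₂ ∘ choice)))
                       (setOf-reindex (ψ ∘ p) unslot unslot-onto)

  ψ-edge : ∀ (p : Fin (suc k) → Face) → IsCEdge H p → IsEdge H (setOf (tabulate λ j → ψ (p j)))
  ψ-edge p (_ , comparable) = sink-edge p linked (proj₁ found) (λ j → proj₂ found (∈-allFin j))
    where
    linked : ∀ i j → i ≢ j → Linked (p i) (p j)
    linked i j i≢j = let (g , g≢0 , cmp) = comparable i j i≢j in comparable⇒linked (p i) (p j) g g≢0 cmp
    -- the arrows among the p j form a transitive tournament
    found : ∃ λ m → ∀ {j} → j ∈ₗ allFin (suc k) → j ≢ m → Arrow (p j) (p m)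
    found = sink _≟_ (λ i j → Arrow (p i) (p j)) (linked _ _) (λ i≢l → arrow-trans (linked _ _ i≢l))
                 fzero (allFin (suc k))

  ψ-hom : IsHomCH H ψ
  ψ-hom = ψ-cong , ψ-edge

hom⇒ChiLe : ∀ {n r} {H : Hypergraph n} (ψ : Simplex r H → Fin n) → IsHomCH H ψ → ChiLe r H
hom⇒ChiLe ψ (ψ-cong , ψ-edge) m (colour , proper) =
  colour ∘ ψ , (λ σ τ σ≐τ → cong colour (ψ-cong σ τ σ≐τ)) ,
  λ p cE mono → proper _ (ψ-edge p cE) λ u v u∈ v∈ →
    let (i , ψpi≡u) = ∈S-tabulate (ψ ∘ p) u∈
        (j , ψpj≡v) = ∈S-tabulate (ψ ∘ p) v∈
    in trans (cong colour (sym ψpi≡u)) (trans (mono i j) (cong colour ψpj≡v))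

lemma5p6 : (r : ℕ) → 2 ≤ r → (n : ℕ) → (H : Hypergraph n) → Uniform r H →
    Σ (Simplex r H → Fin n) (IsHomCH H) × ChiLe r H
lemma5p6 zero () n H _
lemma5p6 (suc k) _ n H _ = (ψ , ψ-hom) , hom⇒ChiLe ψ ψ-hom
  where open Construction {n} {k} H
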